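{- For every graph $G$ with maximum degree $\Delta(G)\ge 2$, $\tau'_2(G)\le 6\Delta(G)-4$.
   Context: All graphs are simple and finite. For edges $e,e'$ of a graph $G$, the distance $d_G(e,e')$ is the distance between the corresponding vertices in the line graph $L(G)$. A $2$-tone edge $k$-coloring of $G$ is a map $f$ assigning to each edge a $2$-element subset of $\{1,\dots,k\}$ such that for any two distinct edges $e,e'$, $|f(e)\cap f(e')|<d_G(e,e')$ (so adjacent edges receive disjoint sets and edges at distance two receive distinct sets). $\tau'_2(G)$ denotes the minimum $k$ for which $G$ admits a $2$-tone edge $k$-coloring. -}

module Defs where

open import Data.Nat using (ℕ; zero; suc; _<_; _⊔_)
open import Data.Bool using (Bool; true; false; T)
open import Data.Fin using (Fin; toℕ)
open import Data.Fin.Subset using (Subset; _∩_; ∣_∣)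
open import Data.Vec using (tabulate)
open import Data.List using (List; foldr; map; allFin)
open import Data.Product using (_×_; Σ)
open import Data.Sum using (_⊎_)
open import Relation.Nullary using (¬_)
open import Relation.Binary.PropositionalEquality using (_≡_)

record Graph : Set where
  field
    n     : ℕ
    Adj   : Fin n → Fin n → Bool
    sym   : ∀ u v → Adj u v ≡ Adj v u
    irrefl : ∀ v → Adj v v ≡ false
open Graph public

nbhd : (G : Graph) → Fin (n G) → Subset (n G)
nbhd G v = tabulate (Adj G v)

degree : (G : Graph) → Fin (n G) → ℕ
degree G v = ∣ nbhd G v ∣

maxDegree : Graph → ℕ
maxDegree G = foldr _⊔_ 0 (map (degree G) (allFin (n G)))

-- An edge {u,v}, represented canonically with toℕ u < toℕ v.
record Edge (G : Graph) : Set where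
  constructor edge
  field
    lo  : Fin (n G)
    hi  : Fin (n G)
    lt  : toℕ lo < toℕ hi
    adj : T (Adj G lo hi)
open Edge public

SameEdge : {G : Graph} → Edge G → Edge G → Set
SameEdge e e' = (lo e ≡ lo e') × (hi e ≡ hi e')

ShareEndpoint : {G : Graph} → Edge G → Edge G → Set
ShareEndpoint e e' =
  (lo e ≡ lo e') ⊎ (lo e ≡ hi e') ⊎ (hi e ≡ lo e') ⊎ (hi e ≡ hi e')

LineAdj : {G : Graph} → Edge G → Edge G → Set
LineAdj e e' = ¬ SameEdge e e' × ShareEndpoint e e'

-- LWalk e e' d : there is a walk of length d from e to e' in L(G).
-- d_G(e,e') is the least such d (infinite if none exists).
data LWalk {G : Graph} : Edge G → Edge G → ℕ → Set where
  here : ∀ {e e'} → SameEdge e e' → LWalk e e' zero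
  step : ∀ {e e'' e' d} → LineAdj e e'' → LWalk e'' e' d → LWalk e e' (suc d)

-- 2-tone edge k-coloring: each edge gets a 2-subset of a k-set, and for
-- distinct edges |f(e) ∩ f(e')| < d_G(e,e').  Since d_G(e,e') is the minimum
-- walk length in L(G), this is: |f(e) ∩ f(e')| < d for every walk length d.
record TwoToneEdgeColoring (G : Graph) (k : ℕ) : Set where
  field
    col      : Edge G → Subset k
    twoElem  : ∀ e → ∣ col e ∣ ≡ 2
    distance : ∀ e e' → ¬ SameEdge e e' → ∀ d → LWalk e e' d →
               ∣ col e ∩ col e' ∣ < d

-- τ'_2(G) ≤ k  iff  G admits a 2-tone edge k-coloring
-- (colorings are monotone in k: a k-coloring is also a (k+1)-coloring).
τ₂′≤ : Graph → ℕ → Set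
τ₂′≤ G k = TwoToneEdgeColoring G k

-- Both labels come from greedy colourings. First a proper edge colouring c₁
-- with 2Δ − 1 colours, since an edge meets at most 2(Δ − 1) others. Then a
-- proper edge colouring c₂ with 4Δ − 3 further colours that also separates
-- any two edges at distance two having the same c₁-colour: for an edge xy,
-- each of the at most 2(Δ − 1) edges zw with z ∈ {x, y} forbids its own colour
-- and that of at most one edge beyond w, the edge at w of c₁-colour c₁(xy),
-- which is unique because c₁ is proper. The label {c₁(e), c₂(e)}, drawn from
-- disjoint palettes, is then a 2-tone colouring with (2Δ − 1) + (4Δ − 3)
-- colours: adjacent edges get disjoint labels, and edges at distance two
-- differ in c₁ or in c₂.
module Submission where

open import Defs hiding (sym; n)
open Graph using (n)

open import Level using () renaming (_⊔_ to _⊔ℓ_)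
open import Data.Nat using (ℕ; zero; suc; _≤_; _<_; _+_; _*_; _∸_; _⊔_; z≤n; s≤s; s≤s⁻¹)
import Data.Nat.Properties as ℕ
open import Data.Nat.Tactic.RingSolver using (solve-∀)
open import Data.Bool using (true; false; T; if_then_else_; _∧_)
open import Data.Bool.Properties using (T-≡)
open import Data.Fin using (Fin; zero; suc)
import Data.Fin as Fin
open import Data.Fin.Properties using (¬∀⟶∃¬; injective⇒≤) renaming (any? to anyFin?)
open import Data.Fin.Subset using (Subset; inside; outside; ⁅_⁆; _∩_; _-_; ∣_∣; Empty)
  renaming (_∈_ to _∈ˢ_)
open import Data.Fin.Subset.Properties
  using (Empty-unique; ∣⊥∣≡0; ∣⁅x⁆∣≡1; ∣p∩q∣≤∣p∣; x∈p∩q⁻; x∈⁅y⁆⇒x≡y; x∈p⇒∣p-x∣<∣p∣; x∈p∧x≢y⇒x∈p-y)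
open import Data.List using (List; []; _∷_; _++_; length; map; allFin; cartesianProduct)
import Data.List as List
open import Data.List.Properties using (length-map; length-++; foldr-preservesᵒ)
open import Data.List.Membership.Propositional using (_∈_; _∉_; lose)
open import Data.List.Membership.Propositional.Properties
  using (∈-map⁺; ∈-allFin; ∈-++⁺ˡ; ∈-++⁺ʳ; ∈-cartesianProduct⁺)
open import Data.List.Relation.Unary.Any using (Any; here; there; index; any?)
import Data.List.Relation.Unary.Any as Any
open import Data.List.Relation.Unary.Any.Properties using (lookup-index; map⁺; ++⁺ˡ; ++⁺ʳ)
open import Data.Vec using ([]; _∷_)
import Data.Vec as Vec
open import Data.Vec.Properties using (zipWith-++; lookup⇒[]=; lookup∘tabulate)
open import Data.Product using (∃; _×_; _,_; proj₁; proj₂)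
open import Data.Sum using (_⊎_; inj₁; inj₂; [_,_])
open import Function using (_∘_)
open import Function.Bundles using (Equivalence)
open import Function.Definitions using (Congruent)
open import Relation.Nullary using (¬_; yes; no; does; map′; contradiction)
open import Relation.Nullary.Decidable using (_×-dec_; _⊎-dec_; T?)
open import Relation.Binary
  using (IsDecEquivalence; Rel; Symmetric; Transitive; Decidable; DecidableEquality; _Respectsˡ_)
open import Relation.Unary using () renaming (Decidable to Decidable₁)
open import Relation.Binary.PropositionalEquality
  using (_≡_; _≢_; refl; sym; trans; cong; cong₂; subst; module ≡-Reasoning)

private
  variable
    k m l : ℕ

length<⇒∃∉ : (xs : List (Fin k)) → length xs < k → ∃ λ γ → γ ∉ xs
length<⇒∃∉ {k} xs short = ¬∀⟶∃¬ k (_∈ xs) (λ γ → any? (γ Fin.≟_) xs) not-all-present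
  where
  not-all-present : ¬ (∀ γ → γ ∈ xs)
  not-all-present ∈xs = ℕ.<⇒≱ short (injective⇒≤ index-injective)
    where
    index-injective : ∀ {γ δ} → index (∈xs γ) ≡ index (∈xs δ) → γ ≡ δ
    index-injective {γ} {δ} eq = begin
      γ                              ≡⟨ lookup-index (∈xs γ) ⟩
      List.lookup xs (index (∈xs γ)) ≡⟨ cong (List.lookup xs) eq ⟩
      List.lookup xs (index (∈xs δ)) ≡⟨ sym (lookup-index (∈xs δ)) ⟩
      δ                              ∎
      where open ≡-Reasoning

module GreedyColouring
  {a ℓ r} {A : Set a} {_≈_ : Rel A ℓ} (≈-isDecEquivalence : IsDecEquivalence _≈_)
  (Conflict : Rel A r)
  (conflict-sym : Symmetric Conflict)
  (conflict-respˡ : Conflict Respectsˡ _≈_)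
  (conflict-irrefl : ∀ {x y} → Conflict x y → ¬ x ≈ y)
  {k : ℕ} (conflicts : A → List A)
  (conflicts-short : ∀ x → length (conflicts x) ≤ k)
  (conflicts-complete : ∀ {x y} → Conflict x y → Any (y ≈_) (conflicts x))
  (enumeration : List A) (∈-enumeration : ∀ x → x ∈ enumeration)
  where

  open IsDecEquivalence ≈-isDecEquivalence
    using (_≟_) renaming (refl to ≈-refl; sym to ≈-sym; trans to ≈-trans)

  record ProperOn (D : List A) : Set (a ⊔ℓ ℓ ⊔ℓ r) where
    field
      colour : A → Fin (suc k)
      colour-cong : Congruent _≈_ _≡_ colour
      proper : ∀ {x y} → x ∈ D → y ∈ D → Conflict x y → colour x ≢ colour y

  recolour : (A → Fin (suc k)) → A → Fin (suc k) → A → Fin (suc k)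
  recolour c x γ y = if does (x ≟ y) then γ else c y

  extend : ∀ {D} x → ProperOn D → ProperOn (x ∷ D)
  extend {D} x P = record { colour = c′ ; colour-cong = c′-cong ; proper = c′-proper }
    where
    open ProperOn P
    fresh : ∃ λ γ → γ ∉ map colour (conflicts x)
    fresh = length<⇒∃∉ (map colour (conflicts x))
              (s≤s (subst (_≤ k) (sym (length-map colour (conflicts x))) (conflicts-short x)))

    γ : Fin (suc k)
    γ = proj₁ fresh

    c′ : A → Fin (suc k)
    c′ = recolour colour x γ

    γ-avoids : ∀ {y} → Conflict x y → γ ≢ colour y
    γ-avoids x#y γ≡ = proj₂ fresh (subst (_∈ _) (sym γ≡)
      (map⁺ (Any.map colour-cong (conflicts-complete x#y))))

    c′-cong : Congruent _≈_ _≡_ c′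
    c′-cong {y} {y′} y≈y′ with x ≟ y | x ≟ y′
    ... | yes _   | yes _    = refl
    ... | yes x≈y | no x≉y′  = contradiction (≈-trans x≈y y≈y′) x≉y′
    ... | no x≉y  | yes x≈y′ = contradiction (≈-trans x≈y′ (≈-sym y≈y′)) x≉y
    ... | no _    | no _     = colour-cong y≈y′

    ∈-tail : ∀ {y} → y ∈ x ∷ D → ¬ x ≈ y → y ∈ D
    ∈-tail (here refl) x≉x = contradiction ≈-refl x≉x
    ∈-tail (there y∈D) _ = y∈D

    c′-proper : ∀ {y z} → y ∈ x ∷ D → z ∈ x ∷ D → Conflict y z → c′ y ≢ c′ z
    c′-proper {y} {z} y∈ z∈ y#z with x ≟ y | x ≟ z
    ... | yes x≈y | yes x≈z = contradiction (≈-trans (≈-sym x≈y) x≈z) (conflict-irrefl y#z)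
    ... | yes x≈y | no _    = γ-avoids (conflict-respˡ (≈-sym x≈y) y#z)
    ... | no _    | yes x≈z = γ-avoids (conflict-respˡ (≈-sym x≈z) (conflict-sym y#z)) ∘ sym
    ... | no x≉y  | no x≉z  = proper (∈-tail y∈ x≉y) (∈-tail z∈ x≉z) y#z

  greedy : ∀ D → ProperOn D
  greedy [] = record { colour = λ _ → zero ; colour-cong = λ _ → refl ; proper = λ () }
  greedy (x ∷ D) = extend x (greedy D)

  open ProperOn (greedy enumeration) public using (colour; colour-cong)

  colour-proper : ∀ {x y} → Conflict x y → colour x ≢ colour y
  colour-proper = ProperOn.proper (greedy enumeration) (∈-enumeration _) (∈-enumeration _)

infix 4 _≋_

data _≋_ {A : Set} : A × A → A × A → Set where
  same : ∀ {x y} → (x , y) ≋ (x , y)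
  swap : ∀ {x y} → (x , y) ≋ (y , x)

module _ {A : Set} where

  ≋-sym : Symmetric (_≋_ {A})
  ≋-sym same = same
  ≋-sym swap = swap

  ≋-trans : Transitive (_≋_ {A})
  ≋-trans same q = q
  ≋-trans swap same = swap
  ≋-trans swap swap = same

  ≋-injectiveʳ : ∀ {z u w : A} → (z , u) ≋ (z , w) → u ≡ w
  ≋-injectiveʳ same = refl
  ≋-injectiveʳ swap = refl

  ≋-dec : DecidableEquality A → Decidable (_≋_ {A})
  ≋-dec _≟_ (x , y) (a , b) =
    map′ from to ((x ≟ a ×-dec y ≟ b) ⊎-dec (x ≟ b ×-dec y ≟ a))
    where
    from : (x ≡ a × y ≡ b) ⊎ (x ≡ b × y ≡ a) → (x , y) ≋ (a , b)
    from (inj₁ (refl , refl)) = same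
    from (inj₂ (refl , refl)) = swap
    to : (x , y) ≋ (a , b) → (x ≡ a × y ≡ b) ⊎ (x ≡ b × y ≡ a)
    to same = inj₁ (refl , refl)
    to swap = inj₂ (refl , refl)

  ≋-isDecEquivalence : DecidableEquality A → IsDecEquivalence (_≋_ {A})
  ≋-isDecEquivalence _≟_ = record
    { isEquivalence = record { refl = same ; sym = ≋-sym ; trans = ≋-trans }
    ; _≟_ = ≋-dec _≟_
    }

members : Subset m → List (Fin m)
members [] = []
members (inside ∷ p) = zero ∷ map suc (members p)
members (outside ∷ p) = map suc (members p)

length-members : ∀ (p : Subset m) → length (members p) ≡ ∣ p ∣
length-members [] = refl
length-members (inside ∷ p) = cong suc (trans (length-map suc (members p)) (length-members p))
length-members (outside ∷ p) = trans (length-map suc (members p)) (length-members p)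

∈-members : ∀ {p : Subset m} {x} → x ∈ˢ p → x ∈ members p
∈-members {p = inside ∷ p} Vec.here = here refl
∈-members {p = inside ∷ p} (Vec.there x∈p) = there (∈-map⁺ suc (∈-members x∈p))
∈-members {p = outside ∷ p} (Vec.there x∈p) = ∈-map⁺ suc (∈-members x∈p)

∣p++q∣≡∣p∣+∣q∣ : ∀ (p : Subset m) (q : Subset l) → ∣ p Vec.++ q ∣ ≡ ∣ p ∣ + ∣ q ∣
∣p++q∣≡∣p∣+∣q∣ [] q = refl
∣p++q∣≡∣p∣+∣q∣ (inside ∷ p) q = cong suc (∣p++q∣≡∣p∣+∣q∣ p q)
∣p++q∣≡∣p∣+∣q∣ (outside ∷ p) q = ∣p++q∣≡∣p∣+∣q∣ p q

∣⁅i⁆∩⁅j⁆∣≡0 : ∀ {i j : Fin m} → i ≢ j → ∣ ⁅ i ⁆ ∩ ⁅ j ⁆ ∣ ≡ 0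
∣⁅i⁆∩⁅j⁆∣≡0 {m} {i} {j} i≢j = trans (cong ∣_∣ (Empty-unique disjoint)) (∣⊥∣≡0 m)
  where
  disjoint : Empty (⁅ i ⁆ ∩ ⁅ j ⁆)
  disjoint (x , x∈⁅i⁆∩⁅j⁆) with x∈p∩q⁻ ⁅ i ⁆ ⁅ j ⁆ x∈⁅i⁆∩⁅j⁆
  ... | x∈⁅i⁆ , x∈⁅j⁆ = i≢j (trans (sym (x∈⁅y⁆⇒x≡y i x∈⁅i⁆)) (x∈⁅y⁆⇒x≡y j x∈⁅j⁆))

∣⁅i⁆∩⁅j⁆∣≤1 : ∀ (i j : Fin m) → ∣ ⁅ i ⁆ ∩ ⁅ j ⁆ ∣ ≤ 1
∣⁅i⁆∩⁅j⁆∣≤1 i j = ℕ.≤-trans (∣p∩q∣≤∣p∣ ⁅ i ⁆ ⁅ j ⁆) (ℕ.≤-reflexive (∣⁅x⁆∣≡1 i))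

twoTone : Fin m → Fin l → Subset (m + l)
twoTone i j = ⁅ i ⁆ Vec.++ ⁅ j ⁆

∣twoTone∣≡2 : ∀ (i : Fin m) (j : Fin l) → ∣ twoTone i j ∣ ≡ 2
∣twoTone∣≡2 i j = trans (∣p++q∣≡∣p∣+∣q∣ ⁅ i ⁆ ⁅ j ⁆) (cong₂ _+_ (∣⁅x⁆∣≡1 i) (∣⁅x⁆∣≡1 j))

∣twoTone∩twoTone∣-split : ∀ (i k : Fin m) (j l : Fin l) →
                ∣ twoTone i j ∩ twoTone k l ∣ ≡ ∣ ⁅ i ⁆ ∩ ⁅ k ⁆ ∣ + ∣ ⁅ j ⁆ ∩ ⁅ l ⁆ ∣
∣twoTone∩twoTone∣-split i k j l = begin
  ∣ twoTone i j ∩ twoTone k l ∣              ≡⟨ cong ∣_∣ (zipWith-++ _∧_ ⁅ i ⁆ ⁅ j ⁆ ⁅ k ⁆ ⁅ l ⁆) ⟩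
  ∣ (⁅ i ⁆ ∩ ⁅ k ⁆) Vec.++ (⁅ j ⁆ ∩ ⁅ l ⁆) ∣  ≡⟨ ∣p++q∣≡∣p∣+∣q∣ (⁅ i ⁆ ∩ ⁅ k ⁆) (⁅ j ⁆ ∩ ⁅ l ⁆) ⟩
  ∣ ⁅ i ⁆ ∩ ⁅ k ⁆ ∣ + ∣ ⁅ j ⁆ ∩ ⁅ l ⁆ ∣    ∎
  where open ≡-Reasoning

∣twoTone∩twoTone∣≡0 : ∀ {i k : Fin m} {j l : Fin l} → i ≢ k → j ≢ l → ∣ twoTone i j ∩ twoTone k l ∣ ≡ 0
∣twoTone∩twoTone∣≡0 {i = i} {k} {j} {l} i≢k j≢l =
  trans (∣twoTone∩twoTone∣-split i k j l) (cong₂ _+_ (∣⁅i⁆∩⁅j⁆∣≡0 i≢k) (∣⁅i⁆∩⁅j⁆∣≡0 j≢l))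

∣twoTone∩twoTone∣≤1 : ∀ (i k : Fin m) (j l : Fin l) → i ≢ k ⊎ j ≢ l → ∣ twoTone i j ∩ twoTone k l ∣ ≤ 1
∣twoTone∩twoTone∣≤1 i k j l distinct = ℕ.≤-trans (ℕ.≤-reflexive (∣twoTone∩twoTone∣-split i k j l)) (bound distinct)
  where
  bound : i ≢ k ⊎ j ≢ l → ∣ ⁅ i ⁆ ∩ ⁅ k ⁆ ∣ + ∣ ⁅ j ⁆ ∩ ⁅ l ⁆ ∣ ≤ 1
  bound (inj₁ i≢k) = ℕ.+-mono-≤ (ℕ.≤-reflexive (∣⁅i⁆∩⁅j⁆∣≡0 i≢k)) (∣⁅i⁆∩⁅j⁆∣≤1 j l)
  bound (inj₂ j≢l) = ℕ.+-mono-≤ (∣⁅i⁆∩⁅j⁆∣≤1 i k) (ℕ.≤-reflexive (∣⁅i⁆∩⁅j⁆∣≡0 j≢l))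

∣twoTone∩twoTone∣≤2 : ∀ (i k : Fin m) (j l : Fin l) → ∣ twoTone i j ∩ twoTone k l ∣ ≤ 2
∣twoTone∩twoTone∣≤2 i k j l = ℕ.≤-trans (∣p∩q∣≤∣p∣ (twoTone i j) (twoTone k l)) (ℕ.≤-reflexive (∣twoTone∣≡2 i j))

degree≤maxDegree : ∀ G v → degree G v ≤ maxDegree G
degree≤maxDegree G v = foldr-preservesᵒ bound-⊔ 0 (map (degree G) (allFin (n G)))
  (inj₂ (lose (∈-map⁺ (degree G) (∈-allFin v)) ℕ.≤-refl))
  where
  bound-⊔ : ∀ x y → degree G v ≤ x ⊎ degree G v ≤ y → degree G v ≤ x ⊔ y
  bound-⊔ x y = [ ℕ.m≤n⇒m≤n⊔o y , ℕ.m≤n⇒m≤o⊔n x ]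

-- An edge {x, y} is handled as the vertex pair (x , y) up to _≋_; colourings
-- of pairs respect _≋_, and the colours of pairs that are not edges are never
-- looked at.
module BoundedDegree (G : Graph) {d : ℕ} (degree≤ : ∀ v → degree G v ≤ suc d) where

  V : Set
  V = Fin (n G)

  infix 4 _∼_
  _∼_ : V → V → Set
  u ∼ v = T (Adj G u v)

  ∼-sym : ∀ {u v} → u ∼ v → v ∼ u
  ∼-sym {u} {v} = subst T (Graph.sym G u v)

  ∼⇒∈nbhd : ∀ {u v} → u ∼ v → v ∈ˢ nbhd G u
  ∼⇒∈nbhd {u} {v} u∼v =
    lookup⇒[]= v (nbhd G u) (trans (lookup∘tabulate (Adj G u) v) (Equivalence.to T-≡ u∼v))

  -- [] when xy is not an edge, so that the length bound holds for every pair
  otherNeighbours : V → V → List V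
  otherNeighbours x y = if Adj G x y then members (nbhd G x - y) else []

  length-otherNeighbours : ∀ x y → length (otherNeighbours x y) ≤ d
  length-otherNeighbours x y with Adj G x y in xy
  ... | false = z≤n
  ... | true = s≤s⁻¹ (begin-strict
    length (members (nbhd G x - y)) ≡⟨ length-members (nbhd G x - y) ⟩
    ∣ nbhd G x - y ∣                 <⟨ x∈p⇒∣p-x∣<∣p∣ (∼⇒∈nbhd (Equivalence.from T-≡ xy)) ⟩
    degree G x                      ≤⟨ degree≤ x ⟩
    suc d                           ∎)
    where open ℕ.≤-Reasoning

  ∈-otherNeighbours : ∀ {x y w} → x ∼ y → x ∼ w → w ≢ y → w ∈ otherNeighbours x y
  ∈-otherNeighbours {x} {y} x∼y x∼w w≢y with Adj G x y | x∼y
  ... | true | _ = ∈-members (x∈p∧x≢y⇒x∈p-y (∼⇒∈nbhd x∼w) w≢y)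

  Pair : Set
  Pair = V × V

  ≋-∈ : ∀ {q r : Pair} {xs} → q ≋ r → r ∈ xs → Any (q ≋_) xs
  ≋-∈ q≋r = Any.map λ { refl → q≋r }

  allPairs : List Pair
  allPairs = cartesianProduct (allFin (n G)) (allFin (n G))

  ∈-allPairs : ∀ p → p ∈ allPairs
  ∈-allPairs (x , y) = ∈-cartesianProduct⁺ (∈-allFin x) (∈-allFin y)

  data AdjacentEdges (p q : Pair) : Set where
    meet : ∀ {z u w} → ¬ p ≋ q → p ≋ (z , u) → q ≋ (z , w) → z ∼ u → z ∼ w → AdjacentEdges p q

  adjacentEdges-sym : Symmetric AdjacentEdges
  adjacentEdges-sym (meet p≉q p≋ q≋ zu zw) = meet (p≉q ∘ ≋-sym) q≋ p≋ zw zu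

  adjacentEdges-respˡ : AdjacentEdges Respectsˡ _≋_
  adjacentEdges-respˡ p≋p′ (meet p≉q p≋ q≋ zu zw) =
    meet (p≉q ∘ ≋-trans p≋p′) (≋-trans (≋-sym p≋p′) p≋) q≋ zu zw

  adjacentEdges-irrefl : ∀ {p q} → AdjacentEdges p q → ¬ p ≋ q
  adjacentEdges-irrefl (meet p≉q _ _ _ _) = p≉q

  lineNeighbours : Pair → List Pair
  lineNeighbours (x , y) = map (x ,_) (otherNeighbours x y) ++ map (y ,_) (otherNeighbours y x)

  length-lineNeighbours : ∀ p → length (lineNeighbours p) ≤ d + d
  length-lineNeighbours (x , y) = begin
    length (lineNeighbours (x , y))
      ≡⟨ length-++ (map (x ,_) (otherNeighbours x y)) ⟩
    length (map (x ,_) (otherNeighbours x y)) + length (map (y ,_) (otherNeighbours y x))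
      ≡⟨ cong₂ _+_ (length-map (x ,_) (otherNeighbours x y)) (length-map (y ,_) (otherNeighbours y x)) ⟩
    length (otherNeighbours x y) + length (otherNeighbours y x)
      ≤⟨ ℕ.+-mono-≤ (length-otherNeighbours x y) (length-otherNeighbours y x) ⟩
    d + d ∎
    where open ℕ.≤-Reasoning

  ∈-lineNeighbours : ∀ {p z u w} → p ≋ (z , u) → ¬ p ≋ (z , w) → z ∼ u → z ∼ w →
                     (z , w) ∈ lineNeighbours p
  ∈-lineNeighbours {x , y} same p≉zw x∼y x∼w =
    ∈-++⁺ˡ (∈-map⁺ (x ,_) (∈-otherNeighbours x∼y x∼w λ { refl → p≉zw same }))
  ∈-lineNeighbours {x , y} swap p≉zw y∼x y∼w =
    ∈-++⁺ʳ _ (∈-map⁺ (y ,_) (∈-otherNeighbours y∼x y∼w λ { refl → p≉zw swap }))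

  adjacentEdges-complete : ∀ {p q} → AdjacentEdges p q → Any (q ≋_) (lineNeighbours p)
  adjacentEdges-complete (meet p≉q p≋ q≋ zu zw) =
    ≋-∈ q≋ (∈-lineNeighbours p≋ (λ p≋zw → p≉q (≋-trans p≋zw (≋-sym q≋))) zu zw)

  open GreedyColouring (≋-isDecEquivalence Fin._≟_) AdjacentEdges adjacentEdges-sym adjacentEdges-respˡ adjacentEdges-irrefl
    lineNeighbours length-lineNeighbours adjacentEdges-complete allPairs ∈-allPairs
    using () renaming (colour to c₁; colour-cong to c₁-cong; colour-proper to c₁-proper)

  c₁-injective-at : ∀ {z u w} → z ∼ u → z ∼ w → c₁ (z , u) ≡ c₁ (z , w) → u ≡ w
  c₁-injective-at {z} {u} {w} z∼u z∼w c₁≡ with u Fin.≟ w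
  ... | yes u≡w = u≡w
  ... | no u≢w = contradiction c₁≡ (c₁-proper (meet (u≢w ∘ ≋-injectiveʳ) same same z∼u z∼w))

  EdgeOfColour : V → Fin (suc (d + d)) → V → Set
  EdgeOfColour w γ v = w ∼ v × c₁ (w , v) ≡ γ

  edgeOfColour? : ∀ w γ → Decidable₁ (EdgeOfColour w γ)
  edgeOfColour? w γ v = T? (Adj G w v) ×-dec c₁ (w , v) Fin.≟ γ

  -- the junk value w when there is no edge of colour γ at w
  partner : V → Fin (suc (d + d)) → V
  partner w γ with anyFin? (edgeOfColour? w γ)
  ... | yes (v , _) = v
  ... | no _ = w

  partner-unique : ∀ {w v γ} → w ∼ v → c₁ (w , v) ≡ γ → partner w γ ≡ v
  partner-unique {w} {v} {γ} w∼v c₁≡γ with anyFin? (edgeOfColour? w γ)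
  ... | yes (v′ , w∼v′ , c₁≡γ′) = c₁-injective-at w∼v′ w∼v (trans c₁≡γ′ (sym c₁≡γ))
  ... | no none = contradiction (v , w∼v , c₁≡γ) none

  data Conflict₂ (p q : Pair) : Set where
    adjacent : AdjacentEdges p q → Conflict₂ p q
    distanceTwo : ∀ {r} → ¬ p ≋ q → AdjacentEdges p r → AdjacentEdges r q → c₁ p ≡ c₁ q → Conflict₂ p q

  conflict₂-sym : Symmetric Conflict₂
  conflict₂-sym (adjacent pq) = adjacent (adjacentEdges-sym pq)
  conflict₂-sym (distanceTwo p≉q pr rq c₁≡) =
    distanceTwo (p≉q ∘ ≋-sym) (adjacentEdges-sym rq) (adjacentEdges-sym pr) (sym c₁≡)

  conflict₂-respˡ : Conflict₂ Respectsˡ _≋_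
  conflict₂-respˡ p≋p′ (adjacent pq) = adjacent (adjacentEdges-respˡ p≋p′ pq)
  conflict₂-respˡ p≋p′ (distanceTwo p≉q pr rq c₁≡) =
    distanceTwo (p≉q ∘ ≋-trans p≋p′) (adjacentEdges-respˡ p≋p′ pr) rq (trans (sym (c₁-cong p≋p′)) c₁≡)

  conflict₂-irrefl : ∀ {p q} → Conflict₂ p q → ¬ p ≋ q
  conflict₂-irrefl (adjacent pq) = adjacentEdges-irrefl pq
  conflict₂-irrefl (distanceTwo p≉q _ _ _) = p≉q

  beyond : Fin (suc (d + d)) → Pair → Pair
  beyond γ (z , w) = w , partner w γ

  -- An edge at distance two from p through the line neighbour (z , w) either
  -- meets p or lies beyond w; in the second case, if it has c₁-colour c₁ p,
  -- it is (w , partner w (c₁ p)) by partner-unique.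
  conflicts₂ : Pair → List Pair
  conflicts₂ p = lineNeighbours p ++ map (beyond (c₁ p)) (lineNeighbours p)

  length-conflicts₂ : ∀ p → length (conflicts₂ p) ≤ (d + d) + (d + d)
  length-conflicts₂ p = begin
    length (conflicts₂ p)
      ≡⟨ length-++ (lineNeighbours p) ⟩
    length (lineNeighbours p) + length (map (beyond (c₁ p)) (lineNeighbours p))
      ≡⟨ cong (length (lineNeighbours p) +_) (length-map (beyond (c₁ p)) (lineNeighbours p)) ⟩
    length (lineNeighbours p) + length (lineNeighbours p)
      ≤⟨ ℕ.+-mono-≤ (length-lineNeighbours p) (length-lineNeighbours p) ⟩
    (d + d) + (d + d) ∎
    where open ℕ.≤-Reasoning

  conflict₂-complete : ∀ {p q} → Conflict₂ p q → Any (q ≋_) (conflicts₂ p)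
  conflict₂-complete (adjacent pq) = ++⁺ˡ (adjacentEdges-complete pq)
  conflict₂-complete {p} {q}
    (distanceTwo p≉q (meet {z} {_} {w} p≉r p≋ r≋ zu zw) (meet {w′} {_} {v} _ r≋′ q≋ _ w′v) c₁≡)
    with ≋-trans (≋-sym r≋) r≋′
  ... | same = ++⁺ˡ (≋-∈ q≋ (∈-lineNeighbours p≋ (λ p≋zv → p≉q (≋-trans p≋zv (≋-sym q≋))) zu w′v))
  ... | swap = ++⁺ʳ (lineNeighbours p) (≋-∈ q≋beyond (∈-map⁺ (beyond (c₁ p)) zw∈))
    where
    zw∈ : (z , w) ∈ lineNeighbours p
    zw∈ = ∈-lineNeighbours p≋ (λ p≋zw → p≉r (≋-trans p≋zw (≋-sym r≋))) zu zw

    q≋beyond : q ≋ beyond (c₁ p) (z , w)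
    q≋beyond = subst (λ v′ → q ≋ (w , v′))
      (sym (partner-unique w′v (trans (c₁-cong (≋-sym q≋)) (sym c₁≡)))) q≋

  open GreedyColouring (≋-isDecEquivalence Fin._≟_) Conflict₂ conflict₂-sym conflict₂-respˡ conflict₂-irrefl
    conflicts₂ length-conflicts₂ conflict₂-complete allPairs ∈-allPairs
    using () renaming (colour to c₂; colour-proper to c₂-proper)

  ⟪_⟫ : Edge G → Pair
  ⟪ e ⟫ = lo e , hi e

  ≋⇒SameEdge : ∀ {e f} → ⟪ e ⟫ ≋ ⟪ f ⟫ → SameEdge e f
  ≋⇒SameEdge same = refl , refl
  ≋⇒SameEdge {edge _ _ a<b _} {edge _ _ b<a _} swap = contradiction (ℕ.<-trans a<b b<a) (ℕ.<-irrefl refl)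

  SameEdge⇒≡ : ∀ {e f} → SameEdge e f → ⟪ e ⟫ ≡ ⟪ f ⟫
  SameEdge⇒≡ (lo≡ , hi≡) = cong₂ _,_ lo≡ hi≡

  shared⇒adjacentEdges : ∀ {e f} → ¬ ⟪ e ⟫ ≋ ⟪ f ⟫ → ShareEndpoint e f → AdjacentEdges ⟪ e ⟫ ⟪ f ⟫
  shared⇒adjacentEdges {edge a b _ a∼b} {edge _ _ _ c∼d} e≉f (inj₁ refl) =
    meet e≉f same same a∼b c∼d
  shared⇒adjacentEdges {edge a b _ a∼b} {edge _ _ _ c∼d} e≉f (inj₂ (inj₁ refl)) =
    meet e≉f same swap a∼b (∼-sym c∼d)
  shared⇒adjacentEdges {edge a b _ a∼b} {edge _ _ _ c∼d} e≉f (inj₂ (inj₂ (inj₁ refl))) =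
    meet e≉f swap same (∼-sym a∼b) c∼d
  shared⇒adjacentEdges {edge a b _ a∼b} {edge _ _ _ c∼d} e≉f (inj₂ (inj₂ (inj₂ refl))) =
    meet e≉f swap swap (∼-sym a∼b) (∼-sym c∼d)

  lineAdj⇒adjacentEdges : ∀ {e f} → LineAdj e f → AdjacentEdges ⟪ e ⟫ ⟪ f ⟫
  lineAdj⇒adjacentEdges {e} {f} (e≠f , shared) = shared⇒adjacentEdges {e} {f} (e≠f ∘ ≋⇒SameEdge {e} {f}) shared

  walk₁⇒adjacentEdges : ∀ {e f} → LWalk e f 1 → AdjacentEdges ⟪ e ⟫ ⟪ f ⟫
  walk₁⇒adjacentEdges {e} {f} (step {e'' = g} e∼g (here g≡f)) =
    subst (AdjacentEdges ⟪ e ⟫) (SameEdge⇒≡ {g} {f} g≡f) (lineAdj⇒adjacentEdges {e} {g} e∼g)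

  walk₂⇒path : ∀ {e f} → LWalk e f 2 → ∃ λ r → AdjacentEdges ⟪ e ⟫ r × AdjacentEdges r ⟪ f ⟫
  walk₂⇒path {e} (step {e'' = g} e∼g g⇝f) = ⟪ g ⟫ , lineAdj⇒adjacentEdges {e} {g} e∼g , walk₁⇒adjacentEdges g⇝f

  twoToneColouring : TwoToneEdgeColoring G (suc (d + d) + suc ((d + d) + (d + d)))
  twoToneColouring = record
    { col = colour
    ; twoElem = λ e → ∣twoTone∣≡2 (c₁ ⟪ e ⟫) (c₂ ⟪ e ⟫)
    ; distance = distance
    }
    where
    colour : Edge G → Subset (suc (d + d) + suc ((d + d) + (d + d)))
    colour e = twoTone (c₁ ⟪ e ⟫) (c₂ ⟪ e ⟫)

    distance : ∀ e f → ¬ SameEdge e f → ∀ k → LWalk e f k → ∣ colour e ∩ colour f ∣ < k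
    distance e f e≠f 0 (here e≡f) = contradiction e≡f e≠f
    distance e f _ 1 walk = s≤s (ℕ.≤-reflexive (∣twoTone∩twoTone∣≡0 (c₁-proper e∼f) (c₂-proper (adjacent e∼f))))
      where
      e∼f : AdjacentEdges ⟪ e ⟫ ⟪ f ⟫
      e∼f = walk₁⇒adjacentEdges walk
    distance e f e≠f 2 walk with c₁ ⟪ e ⟫ Fin.≟ c₁ ⟪ f ⟫ | walk₂⇒path walk
    ... | no c₁≢  | _ = s≤s (∣twoTone∩twoTone∣≤1 (c₁ ⟪ e ⟫) (c₁ ⟪ f ⟫) (c₂ ⟪ e ⟫) (c₂ ⟪ f ⟫) (inj₁ c₁≢))
    ... | yes c₁≡ | _ , e∼r , r∼f =
      s≤s (∣twoTone∩twoTone∣≤1 (c₁ ⟪ e ⟫) (c₁ ⟪ f ⟫) (c₂ ⟪ e ⟫) (c₂ ⟪ f ⟫)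
             (inj₂ (c₂-proper (distanceTwo (e≠f ∘ ≋⇒SameEdge {e} {f}) e∼r r∼f c₁≡))))
    distance e f _ (suc (suc (suc k))) _ =
      s≤s (ℕ.≤-trans (∣twoTone∩twoTone∣≤2 (c₁ ⟪ e ⟫) (c₁ ⟪ f ⟫) (c₂ ⟪ e ⟫) (c₂ ⟪ f ⟫)) (ℕ.m≤m+n 2 k))

colour-count : ∀ d → suc (d + d) + suc ((d + d) + (d + d)) ≡ 6 * suc d ∸ 4
colour-count d = sym (begin
  6 * suc d ∸ 4                                     ≡⟨ cong (_∸ 4) (six-times d) ⟩
  4 + (suc (d + d) + suc ((d + d) + (d + d))) ∸ 4   ≡⟨ ℕ.m+n∸m≡n 4 _ ⟩
  suc (d + d) + suc ((d + d) + (d + d))             ∎)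
  where
  open ≡-Reasoning
  six-times : ∀ d → 6 * suc d ≡ 4 + (suc (d + d) + suc ((d + d) + (d + d)))
  six-times = solve-∀

τ₂′≤6Δ-4 : ∀ G {d} → (∀ v → degree G v ≤ suc d) → τ₂′≤ G (6 * suc d ∸ 4)
τ₂′≤6Δ-4 G {d} degree≤ = subst (τ₂′≤ G) (colour-count d) (BoundedDegree.twoToneColouring G degree≤)

mainTheorem2 : (G : Graph) → 2 ≤ maxDegree G → τ₂′≤ G (6 * maxDegree G ∸ 4)
mainTheorem2 G 2≤Δ with maxDegree G | degree≤maxDegree G
mainTheorem2 G () | zero | _
mainTheorem2 G _  | suc d | degree≤ = τ₂′≤6Δ-4 G degree≤
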